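{- Let $v\ge 2$ and $s\ge 2$ be integers. Then (1) $K_{v}^{RT}(2,s,s)\le v^{s-2}(v^{2}-1)$; (2) $K_{v}^{RT}(3,s,2s-1)\le v(v^{s}-1)$.
   Context: For positive integers $m,s$, the RT poset $[m\times s]$ is $\{1,\dots,ms\}$ partitioned into blocks $B_i=\{is+1,\dots,(i+1)s\}$, $i=0,\dots,m-1$, each a chain $is+1\prec\cdots\prec(i+1)s$, with elements of different blocks incomparable. For $A\subseteq\{1,\dots,ms\}$, $\langle A\rangle$ is the smallest down-closed set containing $A$. For an integer $v\ge 2$, the RT distance on $\mathbb{Z}_v^{ms}$ is $d_{RT}(x,y)=|\langle\{i:x_i\ne y_i\}\rangle|$. A code $C\subseteq\mathbb{Z}_v^{ms}$ is an $R$-covering if every $x\in\mathbb{Z}_v^{ms}$ has some $c\in C$ with $d_{RT}(x,c)\le R$; $K_v^{RT}(m,s,R)$ is the minimum size of an $R$-covering. -}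

module Defs where

open import Data.Nat using (ℕ; suc; _+_; _*_; _≤_; _<_; _≤?_; _<?_)
open import Data.Fin using (Fin; toℕ; _≟_)
open import Data.Fin.Subset using (Subset; ∣_∣)
open import Data.Fin.Properties using (any?)
open import Data.Bool using (Bool; true; not)
open import Data.Vec using (tabulate)
open import Data.List using (List; length)
open import Data.List.Relation.Unary.Any using (Any)
open import Data.Product using (Σ; ∃; _×_; _,_)
open import Relation.Binary.PropositionalEquality using (_≡_)
open import Relation.Nullary using (Dec)
open import Relation.Nullary.Decidable using (⌊_⌋; _×-dec_)

-- Points of the RT poset [m × s] are the positions Fin (m * s);
-- position p (0-based) corresponds to the element p+1 of {1,…,ms}.
-- Block B_b consists of positions b*s, …, b*s + s - 1, a chain in the
-- natural order; different blocks are incomparable.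

SameBlock : (m s : ℕ) → Fin (m * s) → Fin (m * s) → Set
SameBlock m s j i =
  Σ (Fin m) λ b → (toℕ b * s ≤ toℕ j × toℕ j < suc (toℕ b) * s)
                × (toℕ b * s ≤ toℕ i × toℕ i < suc (toℕ b) * s)

sameBlock? : (m s : ℕ) → (j i : Fin (m * s)) → Dec (SameBlock m s j i)
sameBlock? m s j i = any? λ b →
  ((toℕ b * s ≤? toℕ j) ×-dec (toℕ j <? suc (toℕ b) * s))
  ×-dec ((toℕ b * s ≤? toℕ i) ×-dec (toℕ i <? suc (toℕ b) * s))

RTLe : (m s : ℕ) → Fin (m * s) → Fin (m * s) → Set
RTLe m s j i = SameBlock m s j i × toℕ j ≤ toℕ i

⪯? : (m s : ℕ) → (j i : Fin (m * s)) → Dec (RTLe m s j i)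
⪯? m s j i = sameBlock? m s j i ×-dec (toℕ j ≤? toℕ i)

downClosure : (m s : ℕ) → Subset (m * s) → Subset (m * s)
downClosure m s A = tabulate λ j →
  ⌊ any? (λ i → (Data.Vec.lookup A i Data.Bool.≟ true) ×-dec ⪯? m s j i) ⌋
  where import Data.Vec; import Data.Bool

Word : (v m s : ℕ) → Set
Word v m s = Fin (m * s) → Fin v

diffSet : (v m s : ℕ) → Word v m s → Word v m s → Subset (m * s)
diffSet v m s x y = tabulate λ i → not ⌊ x i ≟ y i ⌋

dRT : (v m s : ℕ) → Word v m s → Word v m s → ℕ
dRT v m s x y = ∣ downClosure m s (diffSet v m s x y) ∣

IsCovering : (v m s R : ℕ) → List (Word v m s) → Set
IsCovering v m s R C = (x : Word v m s) → Any (λ c → dRT v m s x c ≤ R) C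

-- K_v^{RT}(m,s,R) ≤ N : there is an R-covering code of size at most N
-- (K is the minimum size, so K ≤ N iff such a code exists; a list of
-- length ≤ N has at most N distinct elements)
K≤ : (v m s R N : ℕ) → Set
K≤ v m s R N = ∃ λ (C : List (Word v m s)) → length C ≤ N × IsCovering v m s R C

module Submission where

-- In the RT metric a block contributes the height of its highest disagreement, so it
-- suffices to match a word blockwise above heights e_b with Σ e_b ≤ R. Every codeword
-- vanishes in block 0 except on the top pair, which is the companion of the bottom pair
-- of the last block, and that last block is nonzero. If the word's last block (for m = 2:
-- its bottom pair) is nonzero it is copied and block 0 costs s. Otherwise, for the top
-- pair (P, Q) of the word's block 0, one of the bottom pairs (Q, 0), (0, P), (1, 1) has a
-- companion agreeing with (P, Q) above height k while itself agreeing with (0, 0) above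
-- height l, with k + l ≤ 2; so these two blocks cost (s - 2 + k) + l ≤ s. For m = 3 the
-- middle block copies only the top letter of the word and costs s - 1.

open import Defs
open import Data.Nat using (ℕ; zero; suc; pred; _≤_; _<_; _*_; _∸_; _^_; _+_; z≤n; s≤s; s≤s⁻¹)
open import Data.Nat.Properties hiding (_≟_)
open import Data.Nat.Tactic.RingSolver using (solve-∀)
open import Data.Fin using (Fin; zero; suc; toℕ; combine; remQuot; _≟_)
open import Data.Fin.Properties using (toℕ-combine; combine-remQuot)
open import Data.Fin.Subset using (Subset; ∣_∣)
open import Data.Bool using (true; false; not)
open import Data.Bool.Properties using (T-≡)
open import Data.Vec using (Vec; []; _∷_; _++_; lookup; tabulate; concat; replicate; take; sum)
open import Data.Vec.Properties
  using (lookup∘tabulate; tabulate∘lookup; lookup-concat; ++-injectiveˡ; ≡-dec)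
open import Data.List as List using (List; []; _∷_; length; cartesianProductWith; allFin)
open import Data.List.Properties using (length-++; length-map; length-drop; length-tabulate)
open import Data.List.Relation.Unary.Any as Any using (Any; here; there)
open import Data.List.Relation.Unary.Any.Properties using (map⁺)
open import Data.List.Membership.Propositional using (_∈_; lose)
open import Data.List.Membership.Propositional.Properties using (∈-cartesianProductWith⁺; ∈-allFin)
open import Data.Product using (_×_; ∃; ∃₂; _,_; proj₁; proj₂; uncurry)
open import Data.Unit.Polymorphic using (⊤)
open import Function using (id; _∘_; Equivalence)
open import Relation.Binary.PropositionalEquality
open import Relation.Nullary using (yes; no; contradiction)
open import Relation.Nullary.Decidable using (⌊_⌋; toWitness; fromWitness)

Interval : Set
Interval = ℕ × ℕ

_∈ᴵ_ : ℕ → Interval → Set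
n ∈ᴵ (start , len) = start ≤ n × n < start + len

shift : Interval → Interval
shift (zero , len) = zero , pred len
shift (suc start , len) = start , len

∈ᴵ-shift : ∀ {n} I → suc n ∈ᴵ I → n ∈ᴵ shift I
∈ᴵ-shift (zero , suc len) (_ , s≤s n<len) = z≤n , n<len
∈ᴵ-shift (suc start , len) (s≤s start≤n , s≤s n<end) = start≤n , n<end

length-shift : ∀ I → proj₂ (shift I) ≤ proj₂ I
length-shift (zero , _) = pred[n]≤n
length-shift (suc _ , _) = ≤-refl

length-shift-< : ∀ I → 0 ∈ᴵ I → proj₂ (shift I) < proj₂ I
length-shift-< (zero , suc len) _ = n<1+n len

totalLength : ∀ {k} → (Fin k → Interval) → ℕ
totalLength I = sum (tabulate (proj₂ ∘ I))

totalLength-shift : ∀ {k} (I : Fin k → Interval) → totalLength (shift ∘ I) ≤ totalLength I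
totalLength-shift {zero} I = z≤n
totalLength-shift {suc k} I = +-mono-≤ (length-shift (I zero)) (totalLength-shift (I ∘ suc))

totalLength-shift-< : ∀ {k} (I : Fin k → Interval) b → 0 ∈ᴵ I b → totalLength (shift ∘ I) < totalLength I
totalLength-shift-< I zero 0∈ =
  +-mono-<-≤ (length-shift-< (I zero) 0∈) (totalLength-shift (I ∘ suc))
totalLength-shift-< I (suc b) 0∈ =
  +-mono-≤-< (length-shift (I zero)) (totalLength-shift-< (I ∘ suc) b 0∈)

_CoveredBy_ : ∀ {n k} → Subset n → (Fin k → Interval) → Set
p CoveredBy I = ∀ i → lookup p i ≡ true → ∃ λ b → toℕ i ∈ᴵ I b

coveredBy-shift : ∀ {n k x} {p : Subset n} {I : Fin k → Interval} →
  (x ∷ p) CoveredBy I → p CoveredBy (shift ∘ I)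
coveredBy-shift {I = I} covers i i∈p with covers (suc i) i∈p
... | b , 1+i∈ = b , ∈ᴵ-shift (I b) 1+i∈

∣p∣≤totalLength : ∀ {n k} (p : Subset n) (I : Fin k → Interval) → p CoveredBy I → ∣ p ∣ ≤ totalLength I
∣p∣≤totalLength [] I covers = z≤n
∣p∣≤totalLength (false ∷ p) I covers =
  ≤-trans (∣p∣≤totalLength p (shift ∘ I) (coveredBy-shift covers)) (totalLength-shift I)
∣p∣≤totalLength (true ∷ p) I covers with covers zero refl
... | b , 0∈ = ≤-trans (s≤s (∣p∣≤totalLength p (shift ∘ I) (coveredBy-shift covers)))
                       (totalLength-shift-< I b 0∈)

blockStart-mono : ∀ {b b′ s i} → b * s ≤ i → i < suc b′ * s → b * s ≤ b′ * s
blockStart-mono {b} {b′} {s} bs≤i i<end =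
  *-monoˡ-≤ s (s≤s⁻¹ (*-cancelʳ-< s b (suc b′) (≤-<-trans bs≤i i<end)))

∈ᴵ-⪯ : ∀ {m s} {j i : Fin (m * s)} b {len} →
  RTLe m s j i → toℕ i ∈ᴵ (b * s , len) → toℕ j ∈ᴵ (b * s , len)
∈ᴵ-⪯ b ((b′ , (b′s≤j , _) , (_ , i<end)) , j≤i) (bs≤i , i<start+len) =
  ≤-trans (blockStart-mono {b} {toℕ b′} bs≤i i<end) b′s≤j , ≤-<-trans j≤i i<start+len

module _ {a} {A : Set a} where

  Agree≥ : ∀ {n} → ℕ → Vec A n → Vec A n → Set a
  Agree≥ zero    u       w       = u ≡ w
  Agree≥ (suc e) []      []      = ⊤
  Agree≥ (suc e) (_ ∷ u) (_ ∷ w) = Agree≥ e u w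

  agree≥⇒lookup : ∀ {n} e (u w : Vec A n) → Agree≥ e u w → ∀ j → e ≤ toℕ j → lookup u j ≡ lookup w j
  agree≥⇒lookup zero    u       w       u≡w   j       _         = cong (λ u → lookup u j) u≡w
  agree≥⇒lookup (suc e) (_ ∷ u) (_ ∷ w) agree (suc j) (s≤s e≤j) = agree≥⇒lookup e u w agree j e≤j

  agree≥-refl : ∀ {n} e (u : Vec A n) → Agree≥ e u u
  agree≥-refl zero    u       = refl
  agree≥-refl (suc e) []      = _
  agree≥-refl (suc e) (_ ∷ u) = agree≥-refl e u

  agree≥-length : ∀ {n} (u w : Vec A n) → Agree≥ n u w
  agree≥-length []      []      = refl
  agree≥-length (_ ∷ u) (_ ∷ w) = agree≥-length u w

  agree≥-++ʳ : ∀ {n m} e (u w : Vec A n) (z : Vec A m) → Agree≥ e u w → Agree≥ e (u ++ z) (w ++ z)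
  agree≥-++ʳ zero    u       w       z u≡w   = cong (_++ z) u≡w
  agree≥-++ʳ (suc e) []      []      z _     = agree≥-refl (suc e) z
  agree≥-++ʳ (suc e) (_ ∷ u) (_ ∷ w) z agree = agree≥-++ʳ e u w z agree

  agree≥-1 : (q : Vec A 2) (a : A) → Agree≥ 1 q (a ∷ lookup q (suc zero) ∷ [])
  agree≥-1 (_ ∷ _ ∷ []) a = refl

  take-++ : ∀ {k m} (u : Vec A k) (z : Vec A m) → take k (u ++ z) ≡ u
  take-++ []      z = refl
  take-++ (a ∷ u) z = cong (a ∷_) (take-++ u z)

  top : ∀ {t} → Vec A (2 + t) → Vec A 2
  top {zero}  u       = u
  top {suc t} (_ ∷ u) = top u

  -- p ++ q, but of type Vec A (2 + t), the shape of a block of length s = 2 + t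
  _▷_ : ∀ {t} → Vec A t → Vec A 2 → Vec A (2 + t)
  []      ▷ q = q
  (a ∷ p) ▷ q = a ∷ (p ▷ q)

  agree≥-▷ : ∀ {t k} (u : Vec A (2 + t)) (p : Vec A t) {q} → Agree≥ k (top u) q → Agree≥ (t + k) u (p ▷ q)
  agree≥-▷ u       []      agree = agree
  agree≥-▷ (_ ∷ u) (_ ∷ p) agree = agree≥-▷ u p agree

blocks : ∀ {v m s} → Word v m s → Vec (Vec (Fin v) s) m
blocks x = tabulate λ b → tabulate λ j → x (combine b j)

lookup-blocks : ∀ {v m s} (x : Word v m s) b j →
  lookup (lookup (blocks {m = m} {s} x) b) j ≡ x (combine b j)
lookup-blocks x b j =
  trans (cong (λ u → lookup u j) (lookup∘tabulate (λ b → tabulate (x ∘ combine b)) b))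
        (lookup∘tabulate (x ∘ combine b) j)

Near : ∀ {v m s} → ℕ → (X C : Vec (Vec (Fin v) s) m) → Set
Near {m = m} R X C = ∃ λ (e : Vec ℕ m) → sum e ≤ R × ∀ b → Agree≥ (lookup e b) (lookup X b) (lookup C b)

∈-diffSet : ∀ {v m s} (x y : Word v m s) i → lookup (diffSet v m s x y) i ≡ true → x i ≢ y i
∈-diffSet {v} {m} {s} x y i i∈ x≡y = contradiction false≡true λ ()
  where
  open ≡-Reasoning
  false≡true : false ≡ true
  false≡true = begin
    false                        ≡⟨ cong not (Equivalence.to T-≡ (fromWitness x≡y)) ⟨
    not ⌊ x i ≟ y i ⌋            ≡⟨ lookup∘tabulate _ i ⟨
    lookup (diffSet v m s x y) i ≡⟨ i∈ ⟩
    true                         ∎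

∈-downClosure : ∀ {m s} (A : Subset (m * s)) j → lookup (downClosure m s A) j ≡ true →
  ∃ λ i → lookup A i ≡ true × RTLe m s j i
∈-downClosure A j j∈ = toWitness (Equivalence.from T-≡ (trans (sym (lookup∘tabulate _ j)) j∈))

agree≥-block⇒≡ : ∀ {v m s e} (x : Word v m s) (C : Vec (Vec (Fin v) s) m) b j →
  Agree≥ e (lookup (blocks x) b) (lookup C b) → e ≤ toℕ j →
  x (combine b j) ≡ lookup (concat C) (combine b j)
agree≥-block⇒≡ x C b j agree e≤j = begin
  x (combine b j)                 ≡⟨ lookup-blocks x b j ⟨
  lookup (lookup (blocks x) b) j  ≡⟨ agree≥⇒lookup _ _ _ agree j e≤j ⟩
  lookup (lookup C b) j           ≡⟨ lookup-concat C b j ⟨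
  lookup (concat C) (combine b j) ∎
  where open ≡-Reasoning

dRT-concat≤ : ∀ {v m s R} (x : Word v m s) (C : Vec (Vec (Fin v) s) m) →
  Near R (blocks x) C → dRT v m s x (lookup (concat C)) ≤ R
dRT-concat≤ {v} {m} {s} {R} x C (e , sum≤R , agree) = begin
  dRT v m s x c  ≤⟨ ∣p∣≤totalLength (downClosure m s (diffSet v m s x c)) I closure-covered ⟩
  totalLength I  ≡⟨ cong sum (tabulate∘lookup e) ⟩
  sum e          ≤⟨ sum≤R ⟩
  R              ∎
  where
  open ≤-Reasoning
  c : Word v m s
  c = lookup (concat C)

  I : Fin m → Interval
  I b = toℕ b * s , lookup e b

  combine-∈ᴵ : ∀ b j → x (combine b j) ≢ c (combine b j) → toℕ (combine b j) ∈ᴵ I b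
  combine-∈ᴵ b j x≢c rewrite toℕ-combine b j | *-comm s (toℕ b) =
    m≤m+n _ _ , +-monoʳ-< _ (≰⇒> λ e≤j → x≢c (agree≥-block⇒≡ x C b j (agree b) e≤j))

  differ-∈ᴵ : ∀ i → x i ≢ c i → ∃ λ b → toℕ i ∈ᴵ I b
  differ-∈ᴵ i = subst (λ i → x i ≢ c i → ∃ λ b → toℕ i ∈ᴵ I b) (combine-remQuot {m} s i)
    (λ x≢c → proj₁ (remQuot {m} s i) , uncurry combine-∈ᴵ (remQuot {m} s i) x≢c)

  closure-covered : downClosure m s (diffSet v m s x c) CoveredBy I
  closure-covered j j∈ with ∈-downClosure (diffSet v m s x c) j j∈
  ... | i , i∈ , j⪯i with differ-∈ᴵ i (∈-diffSet {m = m} {s} x c i i∈)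
  ... | b , i∈I = b , ∈ᴵ-⪯ {m} {s} (toℕ b) j⪯i i∈I

K≤-byBlocks : ∀ {v m s R N} (code : List (Vec (Vec (Fin v) s) m)) → length code ≤ N →
  (∀ X → Any (Near R X) code) → K≤ v m s R N
K≤-byBlocks code length≤N near =
    List.map (lookup ∘ concat) code
  , ≤-trans (≤-reflexive (length-map _ code)) length≤N
  , λ x → map⁺ (Any.map (λ {C} → dRT-concat≤ x C) (near (blocks x)))

module _ {a b c} {A : Set a} {B : Set b} {C : Set c} where

  length-cartesianProductWith : ∀ (f : A → B → C) xs ys →
    length (cartesianProductWith f xs ys) ≡ length xs * length ys
  length-cartesianProductWith f []       ys = refl
  length-cartesianProductWith f (x ∷ xs) ys = begin
    length (List.map (f x) ys List.++ cartesianProductWith f xs ys) ≡⟨ length-++ (List.map (f x) ys) ⟩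
    length (List.map (f x) ys) + length (cartesianProductWith f xs ys)
      ≡⟨ cong₂ _+_ (length-map (f x) ys) (length-cartesianProductWith f xs ys) ⟩
    length ys + length xs * length ys ∎
    where open ≡-Reasoning

module _ {a} {A : Set a} where

  vectors : List A → ∀ k → List (Vec A k)
  vectors xs zero    = List.[ [] ]
  vectors xs (suc k) = cartesianProductWith _∷_ xs (vectors xs k)

  length-vectors : ∀ xs k → length (vectors xs k) ≡ length xs ^ k
  length-vectors xs zero    = refl
  length-vectors xs (suc k) =
    trans (length-cartesianProductWith _∷_ xs _) (cong (length xs *_) (length-vectors xs k))

  ∈-vectors : ∀ {xs k} → (∀ {a} → a ∈ xs) → (y : Vec A k) → y ∈ vectors xs k
  ∈-vectors complete []      = here refl
  ∈-vectors complete (a ∷ y) = ∈-cartesianProductWith⁺ _∷_ complete (∈-vectors complete y)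

  vectors-∷ : ∀ a as k → vectors (a ∷ as) k ≡ replicate k a ∷ List.drop 1 (vectors (a ∷ as) k)
  vectors-∷ a as zero = refl
  vectors-∷ a as (suc k) rewrite vectors-∷ a as k = refl

length-vectors-allFin : ∀ v k → length (vectors (allFin v) k) ≡ v ^ k
length-vectors-allFin v k = trans (length-vectors (allFin v) k) (cong (_^ k) (length-tabulate id))

nonzeroVectors : ∀ n k → List (Vec (Fin (suc n)) k)
nonzeroVectors n k = List.drop 1 (vectors (allFin (suc n)) k)

length-nonzeroVectors : ∀ n k → length (nonzeroVectors n k) ≡ suc n ^ k ∸ 1
length-nonzeroVectors n k =
  trans (length-drop 1 (vectors (allFin (suc n)) k)) (cong (_∸ 1) (length-vectors-allFin (suc n) k))

∈-nonzeroVectors : ∀ {n k} (y : Vec (Fin (suc n)) k) → y ≢ replicate k zero → y ∈ nonzeroVectors n k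
∈-nonzeroVectors {n} {k} y y≢0 with subst (y ∈_) (vectors-∷ zero _ k) (∈-vectors (∈-allFin _) y)
... | here y≡0 = contradiction y≡0 y≢0
... | there y∈ = y∈

companion : ∀ {n} → Vec (Fin (suc n)) 2 → Vec (Fin (suc n)) 2
companion (b₀   ∷ zero   ∷ []) = zero ∷ b₀ ∷ []
companion (zero ∷ suc b₁ ∷ []) = suc b₁ ∷ zero ∷ []
companion (suc _ ∷ suc _ ∷ []) = zero ∷ zero ∷ []

companion-cover : ∀ {n} (q w : Vec (Fin (2 + n)) 2) →
  ∃ λ b → b ≢ replicate 2 zero ×
    ∃₂ λ k l → k + l ≤ 2 × Agree≥ k q (companion b) × Agree≥ l w b
companion-cover q w@(suc _ ∷ _ ∷ []) = w , (λ ()) , 2 , 0 , ≤-refl , agree≥-length q _ , refl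
companion-cover q w@(zero ∷ suc _ ∷ []) = w , (λ ()) , 2 , 0 , ≤-refl , agree≥-length q _ , refl
companion-cover (_ ∷ suc Q ∷ []) (zero ∷ zero ∷ []) =
  suc Q ∷ zero ∷ [] , (λ ()) , 1 , 1 , ≤-refl , refl , refl
companion-cover (suc P ∷ zero ∷ []) (zero ∷ zero ∷ []) =
  zero ∷ suc P ∷ [] , (λ ()) , 0 , 2 , ≤-refl , refl , refl
companion-cover (zero ∷ zero ∷ []) (zero ∷ zero ∷ []) =
  suc zero ∷ suc zero ∷ [] , (λ ()) , 0 , 2 , ≤-refl , refl , refl

extents₂≤ : ∀ t {k l} → k + l ≤ 2 → t + k + (l + 0) ≤ 2 + t
extents₂≤ t {k} {l} k+l≤2 = begin
  t + k + (l + 0) ≡⟨ regroup t k l ⟩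
  t + (k + l)     ≤⟨ +-monoʳ-≤ t k+l≤2 ⟩
  t + 2           ≡⟨ +-comm t 2 ⟩
  2 + t           ∎
  where
  open ≤-Reasoning
  regroup : ∀ t k l → t + k + (l + 0) ≡ t + (k + l)
  regroup = solve-∀

extents₃≤ : ∀ t {k l} → k + l ≤ 2 → t + k + (t + 1 + (l + 0)) ≤ 2 * (2 + t) ∸ 1
extents₃≤ t {k} {l} k+l≤2 = begin
  t + k + (t + 1 + (l + 0)) ≡⟨ regroup t k l ⟩
  t + (t + 1) + (k + l)     ≤⟨ +-monoʳ-≤ (t + (t + 1)) k+l≤2 ⟩
  t + (t + 1) + 2           ≡⟨ unfold t ⟩
  2 * (2 + t) ∸ 1           ∎
  where
  open ≤-Reasoning
  regroup : ∀ t k l → t + k + (t + 1 + (l + 0)) ≡ t + (t + 1) + (k + l)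
  regroup = solve-∀
  -- the right-hand side is the normal form of 2 * (2 + t) ∸ 1, which has no ∸ left
  unfold : ∀ t → t + (t + 1) + 2 ≡ suc (t + suc (suc (t + 0)))
  unfold = solve-∀

module _ {n t : ℕ} where

  private
    Letter : Set
    Letter = Fin (2 + n)

    Block : Set
    Block = Vec Letter (2 + t)

    zeros : Vec Letter t
    zeros = replicate t zero

  codeBlocks₂ : Vec Letter 2 → Vec Letter t → Vec Block 2
  codeBlocks₂ b z = zeros ▷ companion b ∷ (b ++ z) ∷ []

  code₂ : List (Vec Block 2)
  code₂ = cartesianProductWith codeBlocks₂ (nonzeroVectors (suc n) 2) (vectors (allFin (2 + n)) t)

  length-code₂ : length code₂ ≡ ((2 + n) ^ 2 ∸ 1) * (2 + n) ^ t
  length-code₂ =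
    trans (length-cartesianProductWith codeBlocks₂ (nonzeroVectors (suc n) 2) (vectors (allFin (2 + n)) t))
    (cong₂ _*_ (length-nonzeroVectors (suc n) 2) (length-vectors-allFin (2 + n) t))

  code₂-covers : (X : Vec Block 2) → Any (Near (2 + t) X) code₂
  code₂-covers (u ∷ (w₀ ∷ w₁ ∷ w) ∷ []) with companion-cover (top u) (w₀ ∷ w₁ ∷ [])
  ... | b , b≢0 , k , l , k+l≤2 , agreeᵗ , agreeᵇ =
    lose (∈-cartesianProductWith⁺ codeBlocks₂ (∈-nonzeroVectors b b≢0) (∈-vectors (∈-allFin _) w))
      ( t + k ∷ l ∷ []
      , extents₂≤ t k+l≤2
      , λ { zero       → agree≥-▷ u zeros agreeᵗ
          ; (suc zero) → agree≥-++ʳ l (w₀ ∷ w₁ ∷ []) b w agreeᵇ })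

  codeBlocks₃ : Block → Letter → Vec Block 3
  codeBlocks₃ y a = zeros ▷ companion (take 2 y) ∷ zeros ▷ (zero ∷ a ∷ []) ∷ y ∷ []

  code₃ : List (Vec Block 3)
  code₃ = cartesianProductWith codeBlocks₃ (nonzeroVectors (suc n) (2 + t)) (allFin (2 + n))

  length-code₃ : length code₃ ≡ ((2 + n) ^ (2 + t) ∸ 1) * (2 + n)
  length-code₃ =
    trans (length-cartesianProductWith codeBlocks₃ (nonzeroVectors (suc n) (2 + t)) (allFin (2 + n)))
    (cong₂ _*_ (length-nonzeroVectors (suc n) (2 + t)) (length-tabulate id))

  near-code₃ : ∀ u r w (y : Block) → y ≢ replicate (2 + t) zero → ∀ k l → k + l ≤ 2 →
    Agree≥ k (top u) (companion (take 2 y)) → Agree≥ l w y →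
    Any (Near (2 * (2 + t) ∸ 1) (u ∷ r ∷ w ∷ [])) code₃
  near-code₃ u r w y y≢0 k l k+l≤2 agreeᵗ agreeᵇ =
    lose (∈-cartesianProductWith⁺ codeBlocks₃ (∈-nonzeroVectors y y≢0)
                                              (∈-allFin (lookup (top r) (suc zero))))
      ( t + k ∷ t + 1 ∷ l ∷ []
      , extents₃≤ t k+l≤2
      , λ { zero             → agree≥-▷ u zeros agreeᵗ
          ; (suc zero)       → agree≥-▷ r zeros (agree≥-1 (top r) zero)
          ; (suc (suc zero)) → agreeᵇ })

  code₃-covers : (X : Vec Block 3) → Any (Near (2 * (2 + t) ∸ 1) X) code₃
  code₃-covers (u ∷ r ∷ w ∷ []) with ≡-dec _≟_ w (replicate (2 + t) zero)
  ... | no w≢0 = near-code₃ u r w w w≢0 2 0 ≤-refl (agree≥-length (top u) _) refl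
  ... | yes refl with companion-cover (top u) (zero ∷ zero ∷ [])
  ...   | b , b≢0 , k , l , k+l≤2 , agreeᵗ , agreeᵇ =
    near-code₃ u r _ (b ++ zeros) (b≢0 ∘ ++-injectiveˡ b _) k l k+l≤2
      (subst (Agree≥ k (top u) ∘ companion) (sym (take-++ b zeros)) agreeᵗ)
      (agree≥-++ʳ l (zero ∷ zero ∷ []) b zeros agreeᵇ)

theorem4 : (v s : ℕ) → 2 ≤ v → 2 ≤ s →
    K≤ v 2 s s (v ^ (s ∸ 2) * (v ^ 2 ∸ 1))
      × K≤ v 3 s (2 * s ∸ 1) (v * (v ^ s ∸ 1))
theorem4 (suc (suc n)) (suc (suc t)) _ _ =
    K≤-byBlocks code₂ (≤-reflexive (trans (length-code₂ {n} {t}) (*-comm (v ^ 2 ∸ 1) (v ^ t)))) code₂-covers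
  , K≤-byBlocks code₃ (≤-reflexive (trans (length-code₃ {n} {t}) (*-comm (v ^ (2 + t) ∸ 1) v))) code₃-covers
  where v = suc (suc n)
theorem4 (suc (suc _)) (suc zero) _ (s≤s ())
theorem4 (suc zero) _ (s≤s ()) _
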